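{- Let $\sigma\in\mathfrak{S}_n$. Then $\mathrm{zer}(\mathrm{maj}\text{ -code}(\sigma))=\mathrm{rlmin}(\sigma)$.
   Context: $\mathfrak{S}_n$ is the set of permutations of $\{1,\dots,n\}$, written as words $\sigma=\sigma_1\cdots\sigma_n$. For a word $w=w_1\cdots w_m$ of distinct integers, $\mathrm{maj}(w)=\sum_{j: w_j>w_{j+1}} j$. For $0\le j\le n$, $\sigma^{(j)}$ is the subword of $\sigma$ consisting of the letters $1,\dots,j$ (so $\sigma^{(0)}$ is empty with $\mathrm{maj}=0$). Let $m_j(\sigma)=\mathrm{maj}(\sigma^{(j)})-\mathrm{maj}(\sigma^{(j-1)})$ and $\mathrm{maj}\text{ -code}(\sigma)=(m_1(\sigma),\dots,m_n(\sigma))$. For an integer tuple, $\mathrm{zer}$ is the number of its entries equal to $0$. A value $\sigma_j$ is a right-to-left minimum if $\sigma_j<\sigma_k$ for all $k>j$; $\mathrm{rlmin}(\sigma)$ is their number. -}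

module Defs where

open import Data.Nat using (ℕ; zero; suc; _+_; _<_; _≤ᵇ_; _<ᵇ_)
open import Data.Bool using (Bool; true; false; if_then_else_)
open import Data.List using (List; []; _∷_; map; filter; length; reverse)
open import Data.Fin using (Fin; toℕ)
open import Data.List using (allFin)
open import Data.Integer using (ℤ; +_; _-_)
open import Data.Nat.Properties using (_≤?_; _<?_)
open import Data.Fin.Permutation using (Permutation′; _⟨$⟩ʳ_)
open import Relation.Nullary.Decidable using (⌊_⌋)

-- The one-line word σ₁⋯σₙ of a permutation of {1,…,n}
-- (Fin n value k represents the letter k+1; position i represents i+1).
word : ∀ {n} → Permutation′ n → List ℕ
word {n} σ = map (λ i → suc (toℕ (σ ⟨$⟩ʳ i))) (allFin n)

majFrom : ℕ → List ℕ → ℕ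
majFrom j []           = 0
majFrom j (x ∷ [])     = 0
majFrom j (x ∷ y ∷ ws) =
  (if y <ᵇ x then j else 0) + majFrom (suc j) (y ∷ ws)

maj : List ℕ → ℕ
maj = majFrom 1

subword : ℕ → List ℕ → List ℕ
subword j = filter (λ x → x ≤? j)

majCodeEntry : List ℕ → ℕ → ℤ
majCodeEntry w zero    = + 0
majCodeEntry w (suc j) = + maj (subword (suc j) w) - + maj (subword j w)

majCode : ∀ {n} → Permutation′ n → List ℤ
majCode {n} σ = map (λ k → majCodeEntry (word σ) (suc (toℕ k))) (allFin n)

isZero : ℤ → Bool
isZero (+ 0) = true
isZero _     = false

zer : List ℤ → ℕ
zer [] = 0
zer (x ∷ xs) = (if isZero x then 1 else 0) + zer xs

allGreater : ℕ → List ℕ → Bool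
allGreater x []       = true
allGreater x (y ∷ ys) = if x <ᵇ y then allGreater x ys else false

rlminW : List ℕ → ℕ
rlminW []       = 0
rlminW (x ∷ xs) = (if allGreater x xs then 1 else 0) + rlminW xs

rlmin : ∀ {n} → Permutation′ n → ℕ
rlmin σ = rlminW (word σ)

-- The letter j is the largest letter of σ^(j), which is σ^(j−1) with j inserted. If j
-- is the last letter of σ^(j), the insertion creates and moves no descent, so m_j = 0.
-- Otherwise j creates a new descent while every later descent moves one place right,
-- so m_j > 0. Hence m_j = 0 exactly when no smaller letter follows j in σ, i.e. when j
-- is a right-to-left minimum, and counting these letters over j = 1, …, n gives rlmin(σ).
module Submission where

open import Defs
open import Data.Nat using (ℕ)
open import Data.Fin.Permutation using (Permutation′)
open import Relation.Binary.PropositionalEquality using (_≡_)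

open import Data.Bool using (Bool; true; false; if_then_else_; T)
open import Data.Fin using (toℕ)
open import Data.Fin.Properties using (toℕ<n; toℕ-injective)
open import Data.Fin.Permutation using (_⟨$⟩ʳ_)
open import Data.Integer using (ℤ; +_; _-_)
open import Data.Integer.Properties using (m-n≡m⊖n; n⊖n≡0; ⊖-≥)
open import Data.List using (List; []; _∷_; _++_; [_]; length; null; tabulate; allFin)
open import Data.List.Properties using (filter-accept; filter-reject; filter-++; map-tabulate; length-map; length-tabulate; ++-identityʳ)
open import Data.List.Relation.Unary.All as All using (All; []; _∷_)
open import Data.List.Relation.Unary.All.Properties using (all-filter; map⁺; tabulate⁺)
open import Data.List.Relation.Unary.AllPairs using ([]; _∷_)
open import Data.List.Relation.Unary.Unique.Propositional using (Unique)
import Data.List.Relation.Unary.Unique.Propositional.Properties as Unique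
open import Data.Nat using (zero; suc; _+_; _≤_; _<_; _∸_; z≤n; s≤s; z<s; _<ᵇ_; _≡ᵇ_)
open import Data.Nat.Properties
open import Data.Product using (Σ-syntax; ∃-syntax; _×_; _,_)
open import Data.Sum using (_⊎_; inj₁; inj₂)
open import Function using (_∘_; const)
open import Function.Bundles using (Injection)
open import Function.Properties.Inverse using (↔⇒↣)
open import Relation.Nullary using (Dec; yes; no; contradiction)
open import Relation.Binary.PropositionalEquality using (refl; sym; trans; cong; cong₂; subst; _≢_; ≢-sym; module ≡-Reasoning)

χ : Bool → ℕ
χ b = if b then 1 else 0

count : ℕ → (ℕ → Bool) → ℕ
count zero    f = 0
count (suc n) f = χ (f 0) + count n (f ∘ suc)

-- Letters that do not occur in the word count as right-to-left minima.
isRlmin : List ℕ → ℕ → Bool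
isRlmin []       j = true
isRlmin (x ∷ xs) j = if j ≡ᵇ x then allGreater x xs else isRlmin xs j

Letter : ℕ → ℕ → Set
Letter n x = ∃[ k ] x ≡ suc k × k < n

≡ᵇ-refl : ∀ x → (x ≡ᵇ x) ≡ true
≡ᵇ-refl zero    = refl
≡ᵇ-refl (suc x) = ≡ᵇ-refl x

≢⇒≡ᵇ≡false : ∀ {x y} → x ≢ y → (x ≡ᵇ y) ≡ false
≢⇒≡ᵇ≡false {x} {y} x≢y with x ≡ᵇ y in eq
... | false = refl
... | true  = contradiction (≡ᵇ⇒≡ x y (subst T (sym eq) _)) x≢y

<⇒<ᵇ≡true : ∀ {a b} → a < b → (a <ᵇ b) ≡ true
<⇒<ᵇ≡true {a} {b} a<b with a <ᵇ b | <⇒<ᵇ a<b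
... | true | _ = refl

≤⇒>ᵇ≡false : ∀ {a b} → a ≤ b → (b <ᵇ a) ≡ false
≤⇒>ᵇ≡false {a} {b} a≤b with b <ᵇ a in eq
... | false = refl
... | true  = contradiction (<ᵇ⇒< b a (subst T (sym eq) _)) (≤⇒≯ a≤b)

isZero-n-n : ∀ a → isZero (+ a - + a) ≡ true
isZero-n-n a rewrite m-n≡m⊖n a a | n⊖n≡0 a = refl

isZero-m-n : ∀ {a b} → b < a → isZero (+ a - + b) ≡ false
isZero-m-n {a} {b} b<a rewrite m-n≡m⊖n a b | ⊖-≥ (<⇒≤ b<a) with a ∸ b | m<n⇒0<n∸m b<a
... | suc _ | _ = refl

if-≤ : ∀ (c : Bool) k → (if c then k else 0) ≤ k
if-≤ true  k = ≤-refl
if-≤ false k = z≤n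

if-mono : ∀ (c : Bool) k → (if c then k else 0) ≤ (if c then suc k else 0)
if-mono true  k = n≤1+n k
if-mono false k = z≤n

majFrom-mono : ∀ k w → majFrom k w ≤ majFrom (suc k) w
majFrom-mono k []           = z≤n
majFrom-mono k (x ∷ [])     = z≤n
majFrom-mono k (x ∷ y ∷ ws) = +-mono-≤ (if-mono (y <ᵇ x) k) (majFrom-mono (suc k) (y ∷ ws))

majFrom-++-max : ∀ k x A → All (_< x) A → majFrom k (A ++ [ x ]) ≡ majFrom k A
majFrom-++-max k x []           _                = refl
majFrom-++-max k x (a ∷ [])     (a<x ∷ _)        rewrite ≤⇒>ᵇ≡false (<⇒≤ a<x) = refl
majFrom-++-max k x (a ∷ a′ ∷ A) (_ ∷ a′∷A<x) =
  cong (_+_ (if a′ <ᵇ a then k else 0)) (majFrom-++-max (suc k) x (a′ ∷ A) a′∷A<x)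

-- The new descent x > b has weight at least k > 0 and sits one place right of the
-- descent ending at b that it may replace; all later descents move one place right.
majFrom-insert-max-< : ∀ {k} x A b B → 0 < k → All (_< x) A → b < x →
                       majFrom k (A ++ b ∷ B) < majFrom k (A ++ x ∷ b ∷ B)
majFrom-insert-max-< {k} x [] b B 0<k _ b<x rewrite <⇒<ᵇ≡true b<x = begin-strict
  majFrom k (b ∷ B)           ≤⟨ majFrom-mono k (b ∷ B) ⟩
  majFrom (suc k) (b ∷ B)     <⟨ +-monoˡ-< (majFrom (suc k) (b ∷ B)) 0<k ⟩
  k + majFrom (suc k) (b ∷ B) ∎
  where open ≤-Reasoning
majFrom-insert-max-< {k} x (a ∷ []) b B _ (a<x ∷ _) b<x
  rewrite ≤⇒>ᵇ≡false (<⇒≤ a<x) | <⇒<ᵇ≡true b<x = begin-strict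
  (if b <ᵇ a then k else 0) + majFrom (suc k) (b ∷ B)
    ≤⟨ +-mono-≤ (if-≤ (b <ᵇ a) k) (majFrom-mono (suc k) (b ∷ B)) ⟩
  k + majFrom (suc (suc k)) (b ∷ B)
    <⟨ n<1+n _ ⟩
  suc k + majFrom (suc (suc k)) (b ∷ B) ∎
  where open ≤-Reasoning
majFrom-insert-max-< {k} x (a ∷ a′ ∷ A) b B _ (_ ∷ a′∷A<x) b<x =
  +-monoʳ-< (if a′ <ᵇ a then k else 0) (majFrom-insert-max-< x (a′ ∷ A) b B z<s a′∷A<x b<x)

isZero-maj-insert-max : ∀ x A B → All (_< x) A → All (_< x) B →
                        isZero (+ maj (A ++ x ∷ B) - + maj (A ++ B)) ≡ null B
isZero-maj-insert-max x A [] A<x _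
  rewrite majFrom-++-max 1 x A A<x | ++-identityʳ A = isZero-n-n (maj A)
isZero-maj-insert-max x A (b ∷ B) A<x (b<x ∷ _) =
  isZero-m-n (majFrom-insert-max-< x A b B z<s A<x b<x)

subword-< : ∀ j w → All (_< suc j) (subword j w)
subword-< j w = All.map s≤s (all-filter (_≤? j) w)

subword-suc-∉ : ∀ j w → All (_≢ suc j) w → subword (suc j) w ≡ subword j w
subword-suc-∉ j []       _          = refl
subword-suc-∉ j (y ∷ ys) (y≢ ∷ ys≢) = by-cases (y ≤? j)
  where
  open ≡-Reasoning
  by-cases : Dec (y ≤ j) → subword (suc j) (y ∷ ys) ≡ subword j (y ∷ ys)
  by-cases (yes y≤j) = begin
    subword (suc j) (y ∷ ys) ≡⟨ filter-accept (_≤? suc j) (m≤n⇒m≤1+n y≤j) ⟩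
    y ∷ subword (suc j) ys   ≡⟨ cong (y ∷_) (subword-suc-∉ j ys ys≢) ⟩
    y ∷ subword j ys         ≡⟨ filter-accept (_≤? j) y≤j ⟨
    subword j (y ∷ ys)       ∎
  by-cases (no y≰j) = begin
    subword (suc j) (y ∷ ys) ≡⟨ filter-reject (_≤? suc j) (λ y≤1+j → y≢ (≤-antisym y≤1+j (≰⇒> y≰j))) ⟩
    subword (suc j) ys       ≡⟨ subword-suc-∉ j ys ys≢ ⟩
    subword j ys             ≡⟨ filter-reject (_≤? j) y≰j ⟨
    subword j (y ∷ ys)       ∎

allGreater-suc≡null : ∀ j w → All (_≢ suc j) w → allGreater (suc j) w ≡ null (subword j w)
allGreater-suc≡null j []       _          = refl
allGreater-suc≡null j (y ∷ ys) (y≢ ∷ ys≢) = by-cases (y ≤? j)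
  where
  by-cases : Dec (y ≤ j) → allGreater (suc j) (y ∷ ys) ≡ null (subword j (y ∷ ys))
  by-cases (yes y≤j) rewrite filter-accept (_≤? j) {xs = ys} y≤j | ≤⇒>ᵇ≡false (m≤n⇒m≤1+n y≤j) = refl
  by-cases (no y≰j) rewrite filter-reject (_≤? j) {xs = ys} y≰j
                          | <⇒<ᵇ≡true (≤∧≢⇒< (≰⇒> y≰j) (≢-sym y≢)) = allGreater-suc≡null j ys ys≢

split-Unique : ∀ x w → Unique w →
               All (_≢ x) w ⊎ Σ[ A ∈ List ℕ ] Σ[ B ∈ List ℕ ] w ≡ A ++ x ∷ B × All (_≢ x) A × All (_≢ x) B
split-Unique x []       _            = inj₁ []
split-Unique x (y ∷ ys) (y∉ys ∷ ys!) with y ≟ x | split-Unique x ys ys!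
... | yes refl | _                             = inj₂ ([] , ys , refl , [] , All.map ≢-sym y∉ys)
... | no y≢x   | inj₁ ys≢                      = inj₁ (y≢x ∷ ys≢)
... | no y≢x   | inj₂ (A , B , refl , A≢ , B≢) = inj₂ (y ∷ A , B , refl , y≢x ∷ A≢ , B≢)

isRlmin-∉ : ∀ x w → All (_≢ x) w → isRlmin w x ≡ true
isRlmin-∉ x []       _          = refl
isRlmin-∉ x (y ∷ ys) (y≢ ∷ ys≢) rewrite ≢⇒≡ᵇ≡false (≢-sym y≢) = isRlmin-∉ x ys ys≢

isRlmin-++ : ∀ x A B → All (_≢ x) A → isRlmin (A ++ x ∷ B) x ≡ allGreater x B
isRlmin-++ x []       B _          rewrite ≡ᵇ-refl x = refl
isRlmin-++ x (a ∷ A) B (a≢ ∷ A≢) rewrite ≢⇒≡ᵇ≡false (≢-sym a≢) = isRlmin-++ x A B A≢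

subword-keeps-suc : ∀ j A B → All (_≢ suc j) A → All (_≢ suc j) B →
                    subword (suc j) (A ++ suc j ∷ B) ≡ subword j A ++ suc j ∷ subword j B
subword-keeps-suc j A B A≢ B≢ = trans (filter-++ (_≤? suc j) A (suc j ∷ B))
  (cong₂ _++_ (subword-suc-∉ j A A≢)
    (trans (filter-accept (_≤? suc j) ≤-refl) (cong (suc j ∷_) (subword-suc-∉ j B B≢))))

subword-drops-suc : ∀ j A B → subword j (A ++ suc j ∷ B) ≡ subword j A ++ subword j B
subword-drops-suc j A B = trans (filter-++ (_≤? j) A (suc j ∷ B))
  (cong (subword j A ++_) (filter-reject (_≤? j) 1+n≰n))

isZero-majCodeEntry : ∀ j w → Unique w → isZero (majCodeEntry w (suc j)) ≡ isRlmin w (suc j)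
isZero-majCodeEntry j w w! with split-Unique (suc j) w w!
... | inj₁ w≢ rewrite subword-suc-∉ j w w≢ | isRlmin-∉ (suc j) w w≢ = isZero-n-n (maj (subword j w))
... | inj₂ (A , B , refl , A≢ , B≢)
  rewrite subword-keeps-suc j A B A≢ B≢ | subword-drops-suc j A B
        | isRlmin-++ (suc j) A B A≢ | allGreater-suc≡null j B B≢ =
  isZero-maj-insert-max (suc j) (subword j A) (subword j B) (subword-< j A) (subword-< j B)

count-cong : ∀ n {f g} → (∀ i → f i ≡ g i) → count n f ≡ count n g
count-cong zero    f≗g = refl
count-cong (suc n) f≗g = cong₂ _+_ (cong χ (f≗g 0)) (count-cong n (f≗g ∘ suc))

count-true : ∀ n → count n (const true) ≡ n
count-true zero    = refl
count-true (suc n) = cong suc (count-true n)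

count-update : ∀ n m c g → m < n →
               count n (λ i → if i ≡ᵇ m then c else g i) + χ (g m) ≡ count n g + χ c
count-update (suc n) zero c g _ = begin
  (χ c + X) + χ (g 0) ≡⟨ +-assoc (χ c) X (χ (g 0)) ⟩
  χ c + (X + χ (g 0)) ≡⟨ +-comm (χ c) _ ⟩
  (X + χ (g 0)) + χ c ≡⟨ cong (_+ χ c) (+-comm X (χ (g 0))) ⟩
  (χ (g 0) + X) + χ c ∎
  where
  open ≡-Reasoning
  X = count n (g ∘ suc)
count-update (suc n) (suc m) c g (s≤s m<n) = begin
  (χ (g 0) + _) + χ (g (suc m)) ≡⟨ +-assoc (χ (g 0)) _ _ ⟩
  χ (g 0) + (_ + χ (g (suc m))) ≡⟨ cong (_+_ (χ (g 0))) (count-update n m c (g ∘ suc) m<n) ⟩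
  χ (g 0) + (count n (g ∘ suc) + χ c) ≡⟨ +-assoc (χ (g 0)) _ _ ⟨
  count (suc n) g + χ c ∎
  where open ≡-Reasoning

-- Absent letters contribute to the left-hand count, which the length term compensates.
count-isRlmin : ∀ n w → Unique w → All (Letter n) w →
                count n (isRlmin w ∘ suc) + length w ≡ rlminW w + n
count-isRlmin n []       _            _                           = trans (+-identityʳ _) (count-true n)
count-isRlmin n (x ∷ xs) (x∉xs ∷ xs!) ((k , refl , k<n) ∷ xs∈) = begin
  F + suc (length xs)           ≡⟨ +-assoc F 1 (length xs) ⟨
  (F + 1) + length xs           ≡⟨ cong (_+ length xs) head-update ⟩
  (G + a) + length xs           ≡⟨ cong (_+ length xs) (+-comm G a) ⟩
  (a + G) + length xs           ≡⟨ +-assoc a G (length xs) ⟩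
  a + (G + length xs)           ≡⟨ cong (_+_ a) (count-isRlmin n xs xs! xs∈) ⟩
  a + (rlminW xs + n)           ≡⟨ +-assoc a (rlminW xs) n ⟨
  rlminW (x ∷ xs) + n           ∎
  where
  open ≡-Reasoning
  a = χ (allGreater x xs)
  F = count n (isRlmin (x ∷ xs) ∘ suc)
  G = count n (isRlmin xs ∘ suc)
  head-update : F + 1 ≡ G + a
  head-update = trans (cong (λ b → F + χ b) (sym (isRlmin-∉ x xs (All.map ≢-sym x∉xs))))
                      (count-update n k (allGreater x xs) (isRlmin xs ∘ suc) k<n)

zer-tabulate : ∀ n (g : ℕ → ℤ) → zer (tabulate {n = n} (g ∘ toℕ)) ≡ count n (isZero ∘ g)
zer-tabulate zero    g = refl
zer-tabulate (suc n) g = cong (_+_ (χ (isZero (g 0)))) (zer-tabulate n (g ∘ suc))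

word-unique : ∀ {n} (σ : Permutation′ n) → Unique (word σ)
word-unique {n} σ = Unique.map⁺ letter-injective (Unique.allFin⁺ n)
  where
  letter-injective : ∀ {i j} → suc (toℕ (σ ⟨$⟩ʳ i)) ≡ suc (toℕ (σ ⟨$⟩ʳ j)) → i ≡ j
  letter-injective = Injection.injective (↔⇒↣ σ) ∘ toℕ-injective ∘ suc-injective

word-letters : ∀ {n} (σ : Permutation′ n) → All (Letter n) (word σ)
word-letters σ = map⁺ (tabulate⁺ (λ i → toℕ (σ ⟨$⟩ʳ i) , refl , toℕ<n _))

length-word : ∀ {n} (σ : Permutation′ n) → length (word σ) ≡ n
length-word {n} σ = trans (length-map _ (allFin n)) (length-tabulate (λ i → i))

zer-majCode : ∀ {n} (σ : Permutation′ n) → zer (majCode σ) ≡ count n (isRlmin (word σ) ∘ suc)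
zer-majCode {n} σ = begin
  zer (majCode σ)
    ≡⟨ cong zer (map-tabulate {n = n} (λ i → i) _) ⟩
  zer (tabulate {n = n} (majCodeEntry (word σ) ∘ suc ∘ toℕ))
    ≡⟨ zer-tabulate n (majCodeEntry (word σ) ∘ suc) ⟩
  count n (isZero ∘ majCodeEntry (word σ) ∘ suc)
    ≡⟨ count-cong n (λ j → isZero-majCodeEntry j (word σ) (word-unique σ)) ⟩
  count n (isRlmin (word σ) ∘ suc) ∎
  where open ≡-Reasoning

mainTheorem7 : (n : ℕ) (σ : Permutation′ n) → zer (majCode σ) ≡ rlmin σ
mainTheorem7 n σ = +-cancelʳ-≡ n _ _ (begin
  zer (majCode σ) + n                                ≡⟨ cong₂ _+_ (zer-majCode σ) (sym (length-word σ)) ⟩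
  count n (isRlmin (word σ) ∘ suc) + length (word σ) ≡⟨ count-isRlmin n (word σ) (word-unique σ) (word-letters σ) ⟩
  rlmin σ + n                                        ∎)
  where open ≡-Reasoning
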